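{- Let $G$ be an oriented graph and $(S,T)$ a split of $G$ with $S\neq\emptyset$ and no vertex of $S$ a source. Let $v\in T$. If $v$ is contained in no strong 2-kernel of $G$, then there exists $w\in V(G)\setminus\{v\}$ such that $w$ is an in-neighbour of $v$ and $N^-_G(w)\subseteq N^-_G(v)$, and either $w\in S$ and $w$ is a problem for $v$, or $w\in T$.
   Context: A digraph is a finite directed graph with no loops or parallel edges; an oriented graph has no directed cycle of length two. A set of vertices is stable if no edge has both ends in it; a source is a vertex of in-degree zero. A split of $G$ is a pair $(S,T)$ partitioning $V(G)$ with $S$ stable and $G[T]$ a tournament. $N^-_G(u)$ is the set of in-neighbours of $u$. For $X\subseteq V(G)$ and a vertex $y$, $X$ $k$-covers $y$ if there exist $x\in X$ and a directed path of length at most $k$ (length $0$ allowed) from $x$ to $y$; a vertex $x$ $k$-covers $y$ if $\{x\}$ does. A 2-kernel is a stable set that 2-covers every vertex. A 2-kernel $K$ is strong if for every $u\in T$, either some vertex of $K$ 1-covers $u$, or some vertex of $K\cap T$ 2-covers $u$. For $u\in T$, a vertex $s\in S$ is a problem for $u$ if $s$ is an in-neighbour of $u$, $u$ does not 2-cover $s$, and no vertex of $S$ that is neither an in- nor out-neighbour of $u$ 2-covers $s$. -}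

module Defs where

open import Data.Nat using (ℕ; zero; suc)
open import Data.Fin using (Fin)
open import Data.Bool using (Bool; true; false; T)
open import Data.Product using (Σ; ∃; ∃-syntax; _×_; _,_)
open import Data.Sum using (_⊎_)
open import Relation.Nullary using (¬_)
open import Relation.Binary.PropositionalEquality using (_≡_; _≢_)

-- A digraph on vertex set Fin n: adjacency given by a Boolean matrix
-- (finite, hence decidable), with no loops.  Parallel edges are
-- impossible by construction (at most one edge u → v).
record Digraph : Set where
  field
    n        : ℕ
    adj      : Fin n → Fin n → Bool
    loopless : ∀ (v : Fin n) → ¬ T (adj v v)

open Digraph public

module _ (G : Digraph) where

  V : Set
  V = Fin (n G)

  Edge : V → V → Set
  Edge u v = T (adj G u v)

  Oriented : Set
  Oriented = ∀ (u v : V) → Edge u v → ¬ Edge v u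

  VSet : Set
  VSet = V → Bool

  _∈_ : V → VSet → Set
  v ∈ X = X v ≡ true

  Stable : VSet → Set
  Stable X = ∀ (u v : V) → u ∈ X → v ∈ X → ¬ Edge u v

  Source : V → Set
  Source v = ∀ (u : V) → ¬ Edge u v

  -- directed walk of length at most k from x to y (length 0 allowed).
  -- A walk of length ≤ k yields a directed path of length ≤ k, so this
  -- is the "directed path of length at most k" relation.
  data Walk≤ : ℕ → V → V → Set where
    here : ∀ {k x} → Walk≤ k x x
    step : ∀ {k x z y} → Edge x z → Walk≤ k z y → Walk≤ (suc k) x y

  Covers : ℕ → V → V → Set
  Covers k x y = Walk≤ k x y

  SetCovers : ℕ → VSet → V → Set
  SetCovers k X y = ∃[ x ] (x ∈ X × Covers k x y)

  -- (S , T) is a split with S given as a Boolean predicate and T its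
  -- complement: S stable and G[T] a tournament.
  InT : VSet → V → Set
  InT S u = S u ≡ false

  IsSplit : VSet → Set
  IsSplit S = Stable S
            × (∀ (u v : V) → InT S u → InT S v → u ≢ v → Edge u v ⊎ Edge v u)

  TwoKernel : VSet → Set
  TwoKernel K = Stable K × (∀ (y : V) → SetCovers 2 K y)

  Strong2Kernel : VSet → VSet → Set
  Strong2Kernel S K =
    TwoKernel K
    × (∀ (u : V) → InT S u →
         (∃[ x ] (x ∈ K × Covers 1 x u))
         ⊎ (∃[ x ] (x ∈ K × InT S x × Covers 2 x u)))

  Problem : VSet → V → V → Set
  Problem S u s =
    s ∈ S
    × Edge s u
    × ¬ Covers 2 u s
    × (∀ (s' : V) → s' ∈ S → ¬ Edge s' u → ¬ Edge u s' → ¬ Covers 2 s' s)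

{-# OPTIONS --safe #-}
-- Let K consist of v and the vertices of S non-adjacent to v; K is stable and contains v.
-- A vertex w that K fails to (strongly) cover is an in-neighbour of v which v does not
-- 2-cover and which has no in-neighbour in K ∖ {v}. So every in-neighbour x of w is
-- adjacent to v (by the tournament on T, or because x ∉ K), and v → x would give the
-- 2-path v → x → w; hence x → v. If w ∈ S, the failure of K to 2-cover w is exactly the
-- statement that w is a problem for v.
module Submission where

open import Defs
open import Data.Product using (∃; ∃-syntax; _×_; _,_; proj₁; proj₂)
open import Data.Sum using (_⊎_; inj₁; inj₂; fromInj₁)
open import Function using (_∘_)
open import Relation.Nullary using (¬_)
open import Relation.Binary.PropositionalEquality using (_≡_; _≢_; refl; sym; trans)
open import Data.Nat using (zero; suc)
open import Data.Fin using (Fin; zero; suc; _≟_)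
open import Data.Fin.Properties using (any?)
open import Data.Bool using (true; false; _∨_) renaming (_≟_ to _≟ᵇ_)
open import Data.Empty using (⊥-elim)
open import Relation.Nullary.Decidable using (Dec; yes; no; T?; ⌊_⌋; map′; _×-dec_; ¬?)

Fin-search : ∀ {A : Set} m (P : Fin m → Set) → (∀ i → A ⊎ P i) → A ⊎ (∀ i → P i)
Fin-search zero P f = inj₂ λ ()
Fin-search (suc m) P f with f zero | Fin-search m (λ i → P (suc i)) (λ i → f (suc i))
... | inj₁ a  | _       = inj₁ a
... | inj₂ _  | inj₁ a  = inj₁ a
... | inj₂ p₀ | inj₂ ps = inj₂ λ { zero → p₀ ; (suc i) → ps i }

module Walks (G : Digraph) where

  edge? : ∀ x y → Dec (Edge G x y)
  edge? x y = T? (adj G x y)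

  walk≤? : ∀ k x y → Dec (Walk≤ G k x y)
  walk≤? zero x y = map′ (λ { refl → here }) (λ { here → refl }) (x ≟ y)
  walk≤? (suc k) x y with x ≟ y
  ... | yes refl = yes here
  ... | no x≢y   = map′ (λ { (z , e , w) → step e w }) from
                        (any? λ z → edge? x z ×-dec walk≤? k z y)
    where
    from : Walk≤ G (suc k) x y → ∃[ z ] (Edge G x z × Walk≤ G k z y)
    from here       = ⊥-elim (x≢y refl)
    from (step e w) = _ , e , w

  walk≤-suc : ∀ {k x y} → Walk≤ G k x y → Walk≤ G (suc k) x y
  walk≤-suc here       = here
  walk≤-suc (step e w) = step e (walk≤-suc w)

  in-neighbours-⊆ : ∀ {v y} → ¬ Covers G 2 v y
                  → (∀ x → x ≢ v → Edge G x y → Edge G x v ⊎ Edge G v x)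
                  → ∀ x → Edge G x y → Edge G x v
  in-neighbours-⊆ {v} ¬cov adjacent x xy with x ≟ v
  ... | yes refl = ⊥-elim (¬cov (step xy here))
  ... | no x≢v with adjacent x x≢v xy
  ...   | inj₁ xv = xv
  ...   | inj₂ vx = ⊥-elim (¬cov (step vx (step xy here)))

module Construction (G : Digraph) (S : VSet G) (split : IsSplit G S)
                    (v : V G) (v∈T : InT G S v) where

  open Walks G

  InS : V G → Set
  InS x = _∈_ G x S

  S-or-T : ∀ x → InS x ⊎ InT G S x
  S-or-T x with S x
  ... | true  = inj₁ refl
  ... | false = inj₂ refl

  S∩T-disjoint : ∀ {x} → InS x → ¬ InT G S x
  S∩T-disjoint x∈S x∈T with trans (sym x∈S) x∈T
  ... | ()

  Detached : V G → Set
  Detached x = InS x × ¬ Edge G x v × ¬ Edge G v x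

  detached? : ∀ x → Dec (Detached x)
  detached? x = (S x ≟ᵇ true) ×-dec ¬? (edge? x v) ×-dec ¬? (edge? v x)

  K : VSet G
  K x = ⌊ x ≟ v ⌋ ∨ ⌊ detached? x ⌋

  InK : V G → Set
  InK x = _∈_ G x K

  ∈K-intro : ∀ {x} → x ≡ v ⊎ Detached x → InK x
  ∈K-intro {x} x∈ with x ≟ v | detached? x | x∈
  ... | yes _ | _     | _        = refl
  ... | no _  | yes _ | _        = refl
  ... | no ≢v | no _  | inj₁ ≡v  = ⊥-elim (≢v ≡v)
  ... | no _  | no ¬d | inj₂ d   = ⊥-elim (¬d d)

  ∈K-elim : ∀ {x} → InK x → x ≡ v ⊎ Detached x
  ∈K-elim {x} x∈K with x ≟ v | detached? x
  ... | yes ≡v | _     = inj₁ ≡v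
  ... | no _   | yes d = inj₂ d
  ... | no _   | no _  with x∈K
  ...   | ()

  v∈K : InK v
  v∈K = ∈K-intro (inj₁ refl)

  K-stable : Stable G K
  K-stable x y x∈K y∈K with ∈K-elim x∈K | ∈K-elim y∈K
  ... | inj₁ refl          | inj₁ refl          = loopless G v
  ... | inj₁ refl          | inj₂ (_ , _ , ¬vy) = ¬vy
  ... | inj₂ (_ , ¬xv , _) | inj₁ refl          = ¬xv
  ... | inj₂ (x∈S , _)     | inj₂ (y∈S , _)     = proj₁ split x y x∈S y∈S

  adjacent-unless-detached : ∀ x → x ≢ v → ¬ Detached x → Edge G x v ⊎ Edge G v x
  adjacent-unless-detached x x≢v ¬d with edge? x v | edge? v x | S-or-T x
  ... | yes xv | _      | _        = inj₁ xv
  ... | no _   | yes vx | _        = inj₂ vx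
  ... | no ¬xv | no ¬vx | inj₁ x∈S = ⊥-elim (¬d (x∈S , ¬xv , ¬vx))
  ... | no _   | no _   | inj₂ x∈T = proj₂ split x v x∈T v∈T x≢v

  StronglyCovered : V G → Set
  StronglyCovered y =
    SetCovers G 2 K y
    × (InT G S y → (∃[ x ] (InK x × Covers G 1 x y))
                   ⊎ (∃[ x ] (InK x × InT G S x × Covers G 2 x y)))

  covered₁ : ∀ {x y} → InK x → Covers G 1 x y → StronglyCovered y
  covered₁ x∈K c = (_ , x∈K , walk≤-suc c) , λ _ → inj₁ (_ , x∈K , c)

  covered₂-from-T : ∀ {x y} → InK x → InT G S x → Covers G 2 x y → StronglyCovered y
  covered₂-from-T x∈K x∈T c = (_ , x∈K , c) , λ _ → inj₂ (_ , x∈K , x∈T , c)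

  covered₂-in-S : ∀ {x y} → InS y → InK x → Covers G 2 x y → StronglyCovered y
  covered₂-in-S y∈S x∈K c = (_ , x∈K , c) , λ y∈T → ⊥-elim (S∩T-disjoint y∈S y∈T)

  Witness : V G → Set
  Witness w = w ≢ v × Edge G w v
              × (∀ (x : V G) → Edge G x w → Edge G x v)
              × ((InS w × Problem G S v w) ⊎ InT G S w)

  in-neighbours-⊆-unless-detached : ∀ {y} → ¬ Covers G 2 v y
                                  → (∀ x → Edge G x y → ¬ Detached x)
                                  → ∀ x → Edge G x y → Edge G x v
  in-neighbours-⊆-unless-detached ¬cov undetached =
    in-neighbours-⊆ ¬cov λ x x≢v xy → adjacent-unless-detached x x≢v (undetached x xy)

  in-neighbour-witness-or-covered : ∀ y → y ≢ v → Edge G y v → ∃ Witness ⊎ StronglyCovered y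
  in-neighbour-witness-or-covered y y≢v yv with walk≤? 2 v y | S-or-T y
  ... | yes cov | _ = inj₂ (covered₂-from-T v∈K v∈T cov)
  ... | no ¬cov | inj₁ y∈S
      with any? (λ s → detached? s ×-dec walk≤? 2 s y)
  ...   | yes (s , d , cov) = inj₂ (covered₂-in-S y∈S (∈K-intro (inj₂ d)) cov)
  ...   | no ¬found =
          inj₁ (y , y≢v , yv , in-neighbours-⊆-unless-detached ¬cov undetached , inj₁ (y∈S , problem))
    where
    undetached : ∀ x → Edge G x y → ¬ Detached x
    undetached x xy (x∈S , _) = proj₁ split x y x∈S y∈S xy

    problem : Problem G S v y
    problem = y∈S , yv , ¬cov , λ s s∈S ¬sv ¬vs cov → ¬found (s , (s∈S , ¬sv , ¬vs) , cov)
  in-neighbour-witness-or-covered y y≢v yv | no ¬cov | inj₂ y∈T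
      with any? (λ a → detached? a ×-dec edge? a y)
  ...   | yes (a , d , ay) = inj₂ (covered₁ (∈K-intro (inj₂ d)) (step ay here))
  ...   | no ¬found =
          inj₁ (y , y≢v , yv , in-neighbours-⊆-unless-detached ¬cov undetached , inj₂ y∈T)
    where
    undetached : ∀ x → Edge G x y → ¬ Detached x
    undetached x xy d = ¬found (x , d , xy)

  witness-or-covered : ∀ y → ∃ Witness ⊎ StronglyCovered y
  witness-or-covered y with y ≟ v | edge? v y | detached? y
  ... | yes refl | _      | _     = inj₂ (covered₁ v∈K here)
  ... | no _     | yes vy | _     = inj₂ (covered₁ v∈K (step vy here))
  ... | no _     | no _   | yes d = inj₂ (covered₁ (∈K-intro (inj₂ d)) here)
  ... | no y≢v   | no ¬vy | no ¬d with adjacent-unless-detached y y≢v ¬d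
  ...   | inj₁ yv = in-neighbour-witness-or-covered y y≢v yv
  ...   | inj₂ vy = ⊥-elim (¬vy vy)

  witness-or-strong-2-kernel : ∃ Witness ⊎ ∃[ K ] (Strong2Kernel G S K × _∈_ G v K)
  witness-or-strong-2-kernel with Fin-search (n G) StronglyCovered witness-or-covered
  ... | inj₁ witness = inj₁ witness
  ... | inj₂ covered =
        inj₂ (K , ((K-stable , λ y → proj₁ (covered y)) , λ y → proj₂ (covered y)) , v∈K)

mainTheorem3 : (G : Digraph) → Oriented G → (S : VSet G) → IsSplit G S
    → (∃[ s ] (_∈_ G s S))
    → (∀ (s : V G) → _∈_ G s S → ¬ Source G s)
    → (v : V G) → InT G S v
    → ¬ (∃[ K ] (Strong2Kernel G S K × _∈_ G v K))
    → ∃[ w ] (w ≢ v × Edge G w v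
              × (∀ (x : V G) → Edge G x w → Edge G x v)
              × ((_∈_ G w S × Problem G S v w) ⊎ InT G S w))
mainTheorem3 G _ S split _ _ v v∈T no-kernel =
  fromInj₁ (⊥-elim ∘ no-kernel) witness-or-strong-2-kernel
  where open Construction G S split v v∈T
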